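{- Let $\sigma\ge2$ and $k\ge2$, let $U$ be any rotation of a $\sigma$-ary de Bruijn sequence of order $k$, and let $w_{\mathrm{lin}}=U\,U[0..k-2]$. Let $\chi$ be the size of a smallest suffixient set of $w_{\mathrm{lin}}\$$ and $r$ the number of runs of $\operatorname{BWT}(w_{\mathrm{lin}}\$)$. Then \[\frac{\chi}{r}<\frac{\sigma}{\sigma-1}.\]
   Context: A $\sigma$-ary de Bruijn sequence of order $k$ over an ordered alphabet $\Sigma$ of size $\sigma$ is a cyclic word of length $\sigma^k$ whose cyclic length-$k$ windows are exactly the words of $\Sigma^k$, each once. Strings are 0-indexed; $w[i..j]$ is the substring from $i$ to $j$ inclusive. $\$\notin\Sigma$ is an end-marker smaller than every letter; $w\$$ is $w$ followed by one $\$$, a string over $\Sigma\cup\{\$\}$. $\operatorname{BWT}(w\$)$ is the last column of the matrix of lexicographically sorted cyclic rotations of $w\$$; a run is a maximal block of equal consecutive letters. A substring $x$ (possibly empty) of a string $w$ is right-maximal if $xa$ and $xb$ are substrings of $w$ for distinct letters $a\ne b$; right-extensions are substrings $xa$ with $x$ right-maximal. A set $S$ of positions of $w$ is suffixient if every right-extension of $w$ is a suffix of $w[0..j]$ for some $j\in S$. -}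

module Defs where

open import Data.Nat using (ℕ; zero; suc; _+_; _*_; _∸_; _^_; _<_; _≤_)
open import Data.Fin using (Fin; toℕ) renaming (zero to fzero; suc to fsuc)
import Data.Fin.Properties as FinP
open import Data.Fin.Subset using (Subset; _∈_; ∣_∣)
open import Data.List using (List; []; _∷_; _++_; _∷ʳ_; take; drop; length; map; mapMaybe; last; upTo)
import Data.List.Relation.Binary.Lex.Strict as LexS
open import Data.Product using (Σ; ∃; ∃-syntax; _×_; _,_)
open import Relation.Binary.PropositionalEquality using (_≡_; _≢_)
open import Relation.Nullary using (¬_; does)
open import Data.Bool using (if_then_else_)
import Data.List.Sort

-- Strings are lists; positions are 0-indexed.

_IsSubstringOf_ : ∀ {A : Set} → List A → List A → Set
_IsSubstringOf_ {A} x w = Σ (List A) λ u → Σ (List A) λ v → w ≡ u ++ (x ++ v)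

RightMaximal : ∀ {A : Set} → List A → List A → Set
RightMaximal {A} w x =
  Σ A λ a → Σ A λ b → (a ≢ b) × ((x ∷ʳ a) IsSubstringOf w) × ((x ∷ʳ b) IsSubstringOf w)

RightExtension : ∀ {A : Set} → List A → List A → Set
RightExtension {A} w y =
  Σ (List A) λ x → Σ A λ a → (y ≡ x ∷ʳ a) × RightMaximal w x × ((x ∷ʳ a) IsSubstringOf w)

_IsSuffixOf_ : ∀ {A : Set} → List A → List A → Set
_IsSuffixOf_ {A} y w = Σ (List A) λ u → w ≡ u ++ y

Suffixient : ∀ {A : Set} (w : List A) → Subset (length w) → Set
Suffixient {A} w S =
  ∀ (y : List A) → RightExtension w y →
    Σ (Fin (length w)) λ j → (j ∈ S) × (y IsSuffixOf take (suc (toℕ j)) w)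

IsMinSuffixientSize : ∀ {A : Set} → List A → ℕ → Set
IsMinSuffixientSize w χ =
  (Σ (Subset (length w)) λ S → Suffixient w S × (∣ S ∣ ≡ χ)) ×
  (∀ (S : Subset (length w)) → Suffixient w S → χ ≤ ∣ S ∣)

rotate : ∀ {A : Set} → ℕ → List A → List A
rotate i w = drop i w ++ take i w

-- σ-ary de Bruijn sequence of order k (as a linear representative of the cyclic word):
-- length σ^k, and the cyclic length-k windows are exactly the words of Σ^k, each once.
cycWindow : ∀ {A : Set} → ℕ → List A → ℕ → List A
cycWindow k U i = take k (rotate i U)

IsDeBruijn : (σ k : ℕ) → List (Fin σ) → Set
IsDeBruijn σ k U =
  (length U ≡ σ ^ k) ×
  (∀ (x : List (Fin σ)) → length x ≡ k → ∃[ i ] (i < length U × cycWindow k U i ≡ x)) ×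
  (∀ i j → i < length U → j < length U → cycWindow k U i ≡ cycWindow k U j → i ≡ j)

-- Extended alphabet Σ ∪ {$} is Fin (suc σ): zero is $, suc a is the letter a.
-- Order: the natural order of Fin (suc σ), so $ is smaller than every letter and
-- letters keep their order.

withEnd : ∀ {σ} → List (Fin σ) → List (Fin (suc σ))
withEnd w = map fsuc w ∷ʳ fzero

lexOrder : (σ : ℕ) → _
lexOrder σ = LexS.≤-decTotalOrder (FinP.<-strictTotalOrder (suc σ))

rotations : ∀ {A : Set} → List A → List (List A)
rotations w = map (λ i → rotate i w) (upTo (length w))

BWT : (σ : ℕ) → List (Fin (suc σ)) → List (Fin (suc σ))
BWT σ w = mapMaybe last (sort (rotations w))
  where open Data.List.Sort (lexOrder σ)

runs : ∀ {n} → List (Fin n) → ℕ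
runs [] = 0
runs (x ∷ xs) = suc (go x xs)
  where
  go : ∀ {n} → Fin n → List (Fin n) → ℕ
  go p [] = 0
  go p (y ∷ ys) = (if does (p FinP.≟ y) then 0 else 1) + go y ys

-- Let N = σ^k = |U|, so |w$| = N + k.  Since w[N..N+k−2] = w[0..k−2], every occurrence in w$ ending
-- before position k−1 also ends N positions later; hence the N + 1 positions ≥ k−1 form a suffixient
-- set and χ ≤ N + 1.  For the BWT, keep the sorted rotations of w$ whose first k−1 symbols (their
-- context) avoid $.  Prefixing the context with the BWT symbol (the last symbol of the rotation) yields
-- every word of Σ^k, because U is de Bruijn, so this sequence of k-mers has at least σ^k runs, while
-- the sorted contexts have at most σ^(k−1) runs.  A k-mer changes between neighbours only if the BWT
-- symbol or the context does, so r ≥ σ^k + 1 − σ^(k−1), and then χ(σ − 1) ≤ (N + 1)(σ − 1) < σ r.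

module Submission where

open import Level using (Level)
open import Data.Bool using (if_then_else_)
open import Data.Empty using (⊥-elim)
open import Data.Nat using (ℕ; zero; suc; _+_; _*_; _∸_; _^_; _<_; _≤_; z≤n; s≤s; NonZero)
open import Data.Nat.Properties
open import Data.Nat.Tactic.RingSolver using (solve-∀)
open import Algebra.Properties.CommutativeSemigroup +-commutativeSemigroup
  using () renaming (interchange to +-interchange)
open import Data.Fin using (Fin; toℕ; fromℕ<) renaming (zero to fzero; suc to fsuc)
import Data.Fin.Properties as FinP
open import Data.Fin.Subset using (Subset; ⊤; outside; ∣_∣) renaming (_∈_ to _∈ₛ_)
open import Data.Fin.Subset.Properties using (∈⊤; ∣⊤∣≡n)
open import Data.Vec using ([]; _∷_; there)
open import Data.List
  using (List; []; _∷_; _++_; _∷ʳ_; take; drop; length; map; mapMaybe; last; filter; allFin; cartesianProductWith)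
open import Data.List.Properties
  using ( length-++; length-++-≤ˡ; length-++-sucʳ; length-map; length-take; length-drop; length-tabulate
        ; ++-assoc; map-++; take-map; drop-map; take-take; take++drop≡id; ≡-dec; map-injective; ∷-injective)
open import Data.List.Membership.Propositional using (_∈_)
open import Data.List.Membership.Propositional.Properties
  using ( ∈-map⁺; ∈-map⁻; ∈-filter⁺; ∈-filter⁻; ∈-upTo⁺; ∈-allFin; ∈-∃++; ∈-++⁻; ∈-++⁺ˡ; ∈-++⁺ʳ
        ; ∈-cartesianProductWith⁺; ∈-cartesianProductWith⁻)
open import Data.List.Relation.Binary.Lex.Core using (base; halt; this; next)
open import Data.List.Relation.Binary.Lex.Strict using (Lex-≤)
open import Data.List.Relation.Binary.Permutation.Propositional using (↭-sym)
open import Data.List.Relation.Binary.Permutation.Propositional.Properties using (∈-resp-↭)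
open import Data.List.Relation.Binary.Pointwise using (Pointwise-≡⇒≡)
open import Data.List.Relation.Binary.Subset.Propositional using (_⊆_)
open import Data.List.Relation.Binary.Sublist.Propositional
  using ([]; _∷_; lookup) renaming (_⊆_ to _⊑_; _∷ʳ_ to _∷ʳ′_)
open import Data.List.Relation.Binary.Sublist.Propositional.Properties using (filter-⊆; map⁺)
open import Data.List.Relation.Unary.All using (All; []; _∷_; all?)
import Data.List.Relation.Unary.All as All
import Data.List.Relation.Unary.All.Properties as All
open import Data.List.Relation.Unary.AllPairs using ([]; _∷_)
import Data.List.Relation.Unary.AllPairs as AllPairs
open import Data.List.Relation.Unary.Any using (here; there)
open import Data.List.Relation.Unary.Linked using (Linked; []; [-]; _∷_)
import Data.List.Relation.Unary.Linked as Linked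
import Data.List.Relation.Unary.Linked.Properties as Linked
open import Data.List.Relation.Unary.Unique.Propositional using (Unique)
import Data.List.Relation.Unary.Unique.Propositional.Properties as Unique
import Data.List.Sort
open import Data.Maybe using (Maybe; just; fromMaybe)
open import Data.Product using (Σ; ∃-syntax; _×_; _,_; proj₂)
open import Data.Sum using (inj₁; inj₂)
open import Data.Unit using (tt)
open import Function using (id; _∘′_)
open import Relation.Nullary using (yes; no; does; ¬?)
open import Relation.Binary.Core using (Rel)
open import Relation.Binary.Bundles using (DecTotalOrder)
open import Relation.Binary.Definitions using (DecidableEquality; Transitive; Antisymmetric)
open import Relation.Binary.PropositionalEquality
open import Defs

private variable
  a b c d ℓ : Level
  A B C : Set a

-- Lists and rotations

take-++ˡ : ∀ n (xs ys : List A) → n ≤ length xs → take n (xs ++ ys) ≡ take n xs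
take-++ˡ zero    xs       ys _         = refl
take-++ˡ (suc n) (x ∷ xs) ys (s≤s n≤∣xs∣) = cong (x ∷_) (take-++ˡ n xs ys n≤∣xs∣)

drop-++ˡ : ∀ n (xs ys : List A) → n ≤ length xs → drop n (xs ++ ys) ≡ drop n xs ++ ys
drop-++ˡ zero    xs       ys _         = refl
drop-++ˡ (suc n) (x ∷ xs) ys (s≤s n≤∣xs∣) = drop-++ˡ n xs ys n≤∣xs∣

take-++ʳ : ∀ n (xs ys : List A) → take (length xs + n) (xs ++ ys) ≡ xs ++ take n ys
take-++ʳ n []       ys = refl
take-++ʳ n (x ∷ xs) ys = cong (x ∷_) (take-++ʳ n xs ys)

drop-++ʳ : ∀ n (xs ys : List A) → drop (length xs + n) (xs ++ ys) ≡ drop n ys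
drop-++ʳ n []       ys = refl
drop-++ʳ n (x ∷ xs) ys = drop-++ʳ n xs ys

take-take-≤ : ∀ {n m} (xs : List A) → n ≤ m → take n (take m xs) ≡ take n xs
take-take-≤ {n = n} {m} xs n≤m = trans (take-take n m xs) (cong (λ i → take i xs) (m≤n⇒m⊓n≡m n≤m))

take-++-take : ∀ n (xs : List A) m ys → n ≤ length xs + m → take n (xs ++ take m ys) ≡ take n (xs ++ ys)
take-++-take zero    xs       m ys _   = refl
take-++-take (suc n) []       m ys n≤m = take-take-≤ ys n≤m
take-++-take (suc n) (x ∷ xs) m ys (s≤s n≤) = cong (x ∷_) (take-++-take n xs m ys n≤)

length-take-≤ : ∀ {n} (xs : List A) → n ≤ length xs → length (take n xs) ≡ n
length-take-≤ {n = n} xs n≤ = trans (length-take n xs) (m≤n⇒m⊓n≡m n≤)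

last-∷ʳ : ∀ (xs : List A) x → last (xs ∷ʳ x) ≡ just x
last-∷ʳ []           x = refl
last-∷ʳ (y ∷ [])     x = refl
last-∷ʳ (y ∷ z ∷ zs) x = last-∷ʳ (z ∷ zs) x

last≡just-fromMaybe : ∀ (d x : A) xs → last (x ∷ xs) ≡ just (fromMaybe d (last (x ∷ xs)))
last≡just-fromMaybe d x []       = refl
last≡just-fromMaybe d x (y ∷ ys) = last≡just-fromMaybe d y ys

length-rotate : ∀ i (xs : List A) → length (rotate i xs) ≡ length xs
length-rotate i xs = begin
  length (drop i xs ++ take i xs)         ≡⟨ length-++ (drop i xs) ⟩
  length (drop i xs) + length (take i xs) ≡⟨ +-comm (length (drop i xs)) _ ⟩
  length (take i xs) + length (drop i xs) ≡⟨ length-++ (take i xs) ⟨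
  length (take i xs ++ drop i xs)         ≡⟨ cong length (take++drop≡id i xs) ⟩
  length xs                               ∎
  where open ≡-Reasoning

rotate-++ˡ : ∀ n (xs ys : List A) → n ≤ length xs → rotate n (xs ++ ys) ≡ drop n xs ++ ys ++ take n xs
rotate-++ˡ n xs ys n≤ = begin
  drop n (xs ++ ys) ++ take n (xs ++ ys) ≡⟨ cong₂ _++_ (drop-++ˡ n xs ys n≤) (take-++ˡ n xs ys n≤) ⟩
  (drop n xs ++ ys) ++ take n xs         ≡⟨ ++-assoc (drop n xs) ys (take n xs) ⟩
  drop n xs ++ ys ++ take n xs           ∎
  where open ≡-Reasoning

rotate-++ʳ : ∀ n (xs ys : List A) → rotate (length xs + n) (xs ++ ys) ≡ drop n ys ++ xs ++ take n ys
rotate-++ʳ n xs ys = cong₂ _++_ (drop-++ʳ n xs ys) (take-++ʳ n xs ys)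

drop≡∷⇒drop-suc : ∀ t (xs : List A) {c r} → drop t xs ≡ c ∷ r → drop (suc t) xs ≡ r
drop≡∷⇒drop-suc zero    (x ∷ xs) refl = refl
drop≡∷⇒drop-suc (suc t) (x ∷ xs) eq   = drop≡∷⇒drop-suc t xs eq

drop≡∷⇒take-suc : ∀ t (xs : List A) {c r} → drop t xs ≡ c ∷ r → take (suc t) xs ≡ take t xs ∷ʳ c
drop≡∷⇒take-suc zero    (x ∷ xs) refl = refl
drop≡∷⇒take-suc (suc t) (x ∷ xs) eq   = cong (x ∷_) (drop≡∷⇒take-suc t xs eq)

drop≡∷⇒rotate-suc : ∀ t (xs : List A) {c r} → drop t xs ≡ c ∷ r → rotate (suc t) xs ≡ r ++ (take t xs ∷ʳ c)
drop≡∷⇒rotate-suc t xs eq = cong₂ _++_ (drop≡∷⇒drop-suc t xs eq) (drop≡∷⇒take-suc t xs eq)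

take-suc-length : ∀ (xs : List A) y ys → take (suc (length xs)) (xs ++ y ∷ ys) ≡ xs ∷ʳ y
take-suc-length []       y ys = refl
take-suc-length (x ∷ xs) y ys = cong (x ∷_) (take-suc-length xs y ys)

rotate-rotate : ∀ (w : List A) {i j} → i ≤ length w → j < length w →
  ∃[ t ] t < length w × rotate t (rotate i w) ≡ rotate j w
rotate-rotate w {i} {j} i≤∣w∣ j<∣w∣ with i ≤? j
... | yes i≤j = j ∸ i , ≤-<-trans (m∸n≤m j i) j<∣w∣ , (begin
  rotate (j ∸ i) (S ++ P)                ≡⟨ rotate-++ˡ (j ∸ i) S P j∸i≤∣S∣ ⟩
  drop (j ∸ i) S ++ P ++ take (j ∸ i) S  ≡⟨ rotate-++ʳ (j ∸ i) P S ⟨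
  rotate (length P + (j ∸ i)) (P ++ S)  ≡⟨ cong (λ n → rotate (n + (j ∸ i)) (P ++ S)) ∣P∣≡i ⟩
  rotate (i + (j ∸ i)) (P ++ S)         ≡⟨ cong₂ rotate (m+[n∸m]≡n i≤j) (take++drop≡id i w) ⟩
  rotate j w                            ∎)
  where
  open ≡-Reasoning
  P = take i w
  S = drop i w
  ∣P∣≡i : length P ≡ i
  ∣P∣≡i = length-take-≤ w i≤∣w∣
  j∸i≤∣S∣ : j ∸ i ≤ length S
  j∸i≤∣S∣ = subst (j ∸ i ≤_) (sym (length-drop i w)) (∸-monoˡ-≤ i (<⇒≤ j<∣w∣))
... | no i≰j = length S + j , ∣S∣+j<∣w∣ , (begin
  rotate (length S + j) (S ++ P)  ≡⟨ rotate-++ʳ j S P ⟩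
  drop j P ++ S ++ take j P       ≡⟨ rotate-++ˡ j P S (subst (j ≤_) (sym (length-take-≤ w i≤∣w∣)) (<⇒≤ j<i)) ⟨
  rotate j (P ++ S)               ≡⟨ cong (rotate j) (take++drop≡id i w) ⟩
  rotate j w                      ∎)
  where
  open ≡-Reasoning
  P = take i w
  S = drop i w
  j<i : j < i
  j<i = ≰⇒> i≰j
  ∣S∣+j<∣w∣ : length S + j < length w
  ∣S∣+j<∣w∣ = subst (length S + j <_) (trans (cong (_+ i) (length-drop i w)) (m∸n+n≡m i≤∣w∣))
    (+-monoʳ-< (length S) j<i)

linearised-window≡cycWindow : ∀ m t (u : List A) → t < length u → suc m ≤ length u →
  take (suc m) (drop t (u ++ take m u)) ≡ cycWindow (suc m) u t
linearised-window≡cycWindow m t u t<∣u∣ m<∣u∣ = begin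
  take (suc m) (drop t (u ++ take m u)) ≡⟨ cong (take (suc m)) (drop-++ˡ t u (take m u) (<⇒≤ t<∣u∣)) ⟩
  take (suc m) (S ++ take m u)          ≡⟨ take-++-take (suc m) S m u (+-monoˡ-≤ m 1≤∣S∣) ⟩
  take (suc m) (S ++ u)                 ≡⟨ take-++-take (suc m) S t u (subst (suc m ≤_) (sym ∣S∣+t≡∣u∣) m<∣u∣) ⟨
  take (suc m) (S ++ take t u)          ∎
  where
  open ≡-Reasoning
  S = drop t u
  1≤∣S∣ : 1 ≤ length S
  1≤∣S∣ = subst (1 ≤_) (sym (length-drop t u)) (m<n⇒0<n∸m t<∣u∣)
  ∣S∣+t≡∣u∣ : length S + t ≡ length u
  ∣S∣+t≡∣u∣ = trans (cong (_+ t) (length-drop t u)) (m∸n+n≡m (<⇒≤ t<∣u∣))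

mapMaybe≡map : ∀ {f : A → Maybe B} {g : A → B} {xs} → All (λ x → f x ≡ just (g x)) xs → mapMaybe f xs ≡ map g xs
mapMaybe≡map []                        = refl
mapMaybe≡map (fx≡just ∷ fxs≡just) rewrite fx≡just = cong (_ ∷_) (mapMaybe≡map fxs≡just)

take-mono-Lex-≤ : ∀ {a ℓ₁ ℓ₂} {A : Set a} {_≈_ : Rel A ℓ₁} {_≺_ : Rel A ℓ₂} n {xs ys} →
  Lex-≤ _≈_ _≺_ xs ys → Lex-≤ _≈_ _≺_ (take n xs) (take n ys)
take-mono-Lex-≤ zero    _                = base tt
take-mono-Lex-≤ (suc n) (base _)         = base tt
take-mono-Lex-≤ (suc n) halt             = halt
take-mono-Lex-≤ (suc n) (this x≺y)       = this x≺y
take-mono-Lex-≤ (suc n) (next x≈y xs≤ys) = next x≈y (take-mono-Lex-≤ n xs≤ys)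

length-linearised : ∀ (u e : List A) m → m ≤ length u → length (u ++ take m u ++ e) ≡ length u + (m + length e)
length-linearised u e m m≤∣u∣ = begin
  length (u ++ take m u ++ e)                ≡⟨ length-++ u ⟩
  length u + length (take m u ++ e)          ≡⟨ cong (length u +_) (length-++ (take m u)) ⟩
  length u + (length (take m u) + length e)  ≡⟨ cong (λ n → length u + (n + length e)) (length-take-≤ u m≤∣u∣) ⟩
  length u + (m + length e)                  ∎
  where open ≡-Reasoning

-- Words over an alphabet

length-cartesianProductWith : ∀ (f : A → B → C) xs ys →
  length (cartesianProductWith f xs ys) ≡ length xs * length ys
length-cartesianProductWith f []       ys = refl
length-cartesianProductWith f (x ∷ xs) ys = begin
  length (map (f x) ys ++ cartesianProductWith f xs ys)
    ≡⟨ length-++ (map (f x) ys) ⟩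
  length (map (f x) ys) + length (cartesianProductWith f xs ys)
    ≡⟨ cong₂ _+_ (length-map (f x) ys) (length-cartesianProductWith f xs ys) ⟩
  length ys + length xs * length ys                             ∎
  where open ≡-Reasoning

length-allFin : ∀ n → length (allFin n) ≡ n
length-allFin n = length-tabulate id

words : List A → ℕ → List (List A)
words cs zero    = [] ∷ []
words cs (suc m) = cartesianProductWith _∷_ cs (words cs m)

length-words : ∀ (cs : List A) m → length (words cs m) ≡ length cs ^ m
length-words cs zero    = refl
length-words cs (suc m) = trans (length-cartesianProductWith _∷_ cs (words cs m)) (cong (length cs *_) (length-words cs m))

∈-words : ∀ {cs : List A} {x} → All (_∈ cs) x → x ∈ words cs (length x)
∈-words []           = here refl
∈-words (c∈cs ∷ x∈*) = ∈-cartesianProductWith⁺ _∷_ c∈cs (∈-words x∈*)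

∈-words⇒length : ∀ (cs : List A) m {x} → x ∈ words cs m → length x ≡ m
∈-words⇒length cs zero    (here refl) = refl
∈-words⇒length cs (suc m) x∈ with ∈-cartesianProductWith⁻ _∷_ cs (words cs m) x∈
... | _ , y , _ , y∈ , refl = cong suc (∈-words⇒length cs m y∈)

words-unique : ∀ {cs : List A} m → Unique cs → Unique (words cs m)
words-unique zero    _         = [] ∷ []
words-unique (suc m) cs-unique =
  Unique.cartesianProductWith⁺ _∷_ ∷-injective cs-unique (words-unique m cs-unique)

-- Runs

Unique⇒length≤ : ∀ {us vs : List A} → Unique us → us ⊆ vs → length us ≤ length vs
Unique⇒length≤ {us = []}     _                  _     = z≤n
Unique⇒length≤ {us = u ∷ us} (u∉us ∷ us-unique) us⊆vs with ∈-∃++ (us⊆vs (here refl))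
... | ys , zs , refl = begin
  suc (length us)             ≤⟨ s≤s (Unique⇒length≤ us-unique us⊆ys++zs) ⟩
  suc (length (ys ++ zs))     ≡⟨ cong suc (length-++ ys) ⟩
  suc (length ys + length zs) ≡⟨ +-suc (length ys) (length zs) ⟨
  length ys + length (u ∷ zs) ≡⟨ length-++ ys ⟨
  length (ys ++ u ∷ zs)       ∎
  where
  open ≤-Reasoning
  us⊆ys++zs : us ⊆ ys ++ zs
  us⊆ys++zs {z} z∈us with ∈-++⁻ ys (us⊆vs (there z∈us))
  ... | inj₁ z∈ys         = ∈-++⁺ˡ z∈ys
  ... | inj₂ (here refl)  = ⊥-elim (All.lookup u∉us z∈us refl)
  ... | inj₂ (there z∈zs) = ∈-++⁺ʳ ys z∈zs

module _ (_≟_ : DecidableEquality A) where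

  differ : A → A → ℕ
  differ x y = if does (x ≟ y) then 0 else 1

  runHeadsAfter : A → List A → List A
  runHeadsAfter p []       = []
  runHeadsAfter p (y ∷ ys) = if does (p ≟ y) then runHeadsAfter y ys else y ∷ runHeadsAfter y ys

  runHeads : List A → List A
  runHeads []       = []
  runHeads (x ∷ xs) = x ∷ runHeadsAfter x xs

  length-runHeadsAfter-∷ : ∀ p y ys →
    length (runHeadsAfter p (y ∷ ys)) ≡ differ p y + length (runHeadsAfter y ys)
  length-runHeadsAfter-∷ p y ys with p ≟ y
  ... | yes _ = refl
  ... | no  _ = refl

  differ-triangle : ∀ x y z → differ x z ≤ differ x y + differ y z
  differ-triangle x y z with x ≟ z | x ≟ y | y ≟ z
  ... | yes _    | _        | _        = z≤n
  ... | no _     | no _     | _        = s≤s z≤n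
  ... | no _     | yes _    | no _     = s≤s z≤n
  ... | no x≢z   | yes refl | yes refl = ⊥-elim (x≢z refl)

  length-runHeadsAfter-triangle : ∀ p q ys →
    length (runHeadsAfter p ys) ≤ differ p q + length (runHeadsAfter q ys)
  length-runHeadsAfter-triangle p q []       = z≤n
  length-runHeadsAfter-triangle p q (y ∷ ys) = begin
    length (runHeadsAfter p (y ∷ ys))                       ≡⟨ length-runHeadsAfter-∷ p y ys ⟩
    differ p y + length (runHeadsAfter y ys)                ≤⟨ +-monoˡ-≤ _ (differ-triangle p q y) ⟩
    differ p q + differ q y + length (runHeadsAfter y ys)   ≡⟨ +-assoc (differ p q) _ _ ⟩
    differ p q + (differ q y + length (runHeadsAfter y ys)) ≡⟨ cong (differ p q +_) (length-runHeadsAfter-∷ q y ys) ⟨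
    differ p q + length (runHeadsAfter q (y ∷ ys))          ∎
    where open ≤-Reasoning

  length-runHeadsAfter-mono-⊑ : ∀ {xs ys} → xs ⊑ ys → ∀ p →
    length (runHeadsAfter p xs) ≤ length (runHeadsAfter p ys)
  length-runHeadsAfter-mono-⊑ []                p = z≤n
  length-runHeadsAfter-mono-⊑ {xs} {y ∷ ys} (.y ∷ʳ′ xs⊑ys) p = begin
    length (runHeadsAfter p xs)               ≤⟨ length-runHeadsAfter-triangle p y xs ⟩
    differ p y + length (runHeadsAfter y xs)  ≤⟨ +-monoʳ-≤ (differ p y) (length-runHeadsAfter-mono-⊑ xs⊑ys y) ⟩
    differ p y + length (runHeadsAfter y ys)  ≡⟨ length-runHeadsAfter-∷ p y ys ⟨
    length (runHeadsAfter p (y ∷ ys))         ∎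
    where open ≤-Reasoning
  length-runHeadsAfter-mono-⊑ {x ∷ xs} {.x ∷ ys} (refl ∷ xs⊑ys) p = begin
    length (runHeadsAfter p (x ∷ xs))         ≡⟨ length-runHeadsAfter-∷ p x xs ⟩
    differ p x + length (runHeadsAfter x xs)  ≤⟨ +-monoʳ-≤ (differ p x) (length-runHeadsAfter-mono-⊑ xs⊑ys x) ⟩
    differ p x + length (runHeadsAfter x ys)  ≡⟨ length-runHeadsAfter-∷ p x ys ⟨
    length (runHeadsAfter p (x ∷ ys))         ∎
    where open ≤-Reasoning

  length-runHeads-≤-∷ : ∀ y ys → length (runHeads ys) ≤ length (runHeads (y ∷ ys))
  length-runHeads-≤-∷ y []       = z≤n
  length-runHeads-≤-∷ y (z ∷ zs) =
    s≤s (≤-trans (m≤n+m _ (differ y z)) (≤-reflexive (sym (length-runHeadsAfter-∷ y z zs))))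

  length-runHeads-mono-⊑ : ∀ {xs ys} → xs ⊑ ys → length (runHeads xs) ≤ length (runHeads ys)
  length-runHeads-mono-⊑ []                          = z≤n
  length-runHeads-mono-⊑ {ys = y ∷ ys} (.y ∷ʳ′ xs⊑ys) =
    ≤-trans (length-runHeads-mono-⊑ xs⊑ys) (length-runHeads-≤-∷ y ys)
  length-runHeads-mono-⊑ {x ∷ _} (refl ∷ xs⊑ys)     = s≤s (length-runHeadsAfter-mono-⊑ xs⊑ys x)

  runHeadsAfter-⊑ : ∀ p ys → runHeadsAfter p ys ⊑ ys
  runHeadsAfter-⊑ p []       = []
  runHeadsAfter-⊑ p (y ∷ ys) with p ≟ y
  ... | yes _ = y ∷ʳ′ runHeadsAfter-⊑ y ys
  ... | no  _ = refl ∷ runHeadsAfter-⊑ y ys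

  runHeads-⊑ : ∀ xs → runHeads xs ⊑ xs
  runHeads-⊑ []       = []
  runHeads-⊑ (x ∷ xs) = refl ∷ runHeadsAfter-⊑ x xs

  ∈-runHeads⁺ : ∀ {z} xs → z ∈ xs → z ∈ runHeads xs
  ∈-runHeads⁺ (x ∷ xs)     (here z≡x)   = here z≡x
  ∈-runHeads⁺ (x ∷ y ∷ ys) (there z∈ys) with x ≟ y | ∈-runHeads⁺ (y ∷ ys) z∈ys
  ... | yes refl | z∈heads = z∈heads
  ... | no  _    | z∈heads = there z∈heads

  module _ {_≼_ : Rel A ℓ} (≼-trans : Transitive _≼_) (≼-antisym : Antisymmetric _≡_ _≼_) where

    private
      _≺_ : Rel A _
      x ≺ y = x ≼ y × x ≢ y

      ≺-trans : Transitive _≺_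
      ≺-trans (x≼y , x≢y) (y≼z , _) = ≼-trans x≼y y≼z , λ { refl → x≢y (≼-antisym x≼y y≼z) }

      runHeads-strict : ∀ x ys → Linked _≼_ (x ∷ ys) → Linked _≺_ (x ∷ runHeadsAfter x ys)
      runHeads-strict x []       _               = [-]
      runHeads-strict x (y ∷ ys) (x≼y ∷ sorted) with x ≟ y
      ... | yes refl = runHeads-strict y ys sorted
      ... | no  x≢y  = (x≼y , x≢y) ∷ runHeads-strict y ys sorted

    runHeads-unique : ∀ {xs} → Linked _≼_ xs → Unique (runHeads xs)
    runHeads-unique {[]}     _      = []
    runHeads-unique {x ∷ xs} sorted =
      AllPairs.map proj₂ (Linked.Linked⇒AllPairs ≺-trans (runHeads-strict x xs sorted))

-- runs (x ∷ y ∷ ys) unfolds to suc (differ x y + c), where runs (y ∷ ys) = suc c.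
runs≡length-runHeads : ∀ {n} (xs : List (Fin n)) → runs xs ≡ length (runHeads FinP._≟_ xs)
runs≡length-runHeads []           = refl
runs≡length-runHeads (x ∷ [])     = refl
runs≡length-runHeads (x ∷ y ∷ ys) = begin
  runs (x ∷ y ∷ ys)                                     ≡⟨ +-suc _ _ ⟨
  δ + runs (y ∷ ys)                                     ≡⟨ cong (δ +_) (runs≡length-runHeads (y ∷ ys)) ⟩
  δ + suc (length (runHeadsAfter FinP._≟_ y ys))        ≡⟨ +-suc δ _ ⟩
  suc (δ + length (runHeadsAfter FinP._≟_ y ys))        ≡⟨ cong suc (length-runHeadsAfter-∷ FinP._≟_ x y ys) ⟨
  length (runHeads FinP._≟_ (x ∷ y ∷ ys))               ∎
  where
  open ≡-Reasoning
  δ = differ FinP._≟_ x y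

module _ {B : Set a} {X : Set b} {Y : Set c} {Z : Set d}
  (_≟ˣ_ : DecidableEquality X) (_≟ʸ_ : DecidableEquality Y) (_≟ᶻ_ : DecidableEquality Z)
  (f : B → X) (g : B → Y) (h : B → Z) (h-determined : ∀ {u v} → f u ≡ f v → g u ≡ g v → h u ≡ h v)
  where

  private
    differ-determined : ∀ u v → differ _≟ᶻ_ (h u) (h v) ≤ differ _≟ˣ_ (f u) (f v) + differ _≟ʸ_ (g u) (g v)
    differ-determined u v with f u ≟ˣ f v | g u ≟ʸ g v | h u ≟ᶻ h v
    ... | _         | _         | yes _   = z≤n
    ... | yes fu≡fv | yes gu≡gv | no hu≢hv = ⊥-elim (hu≢hv (h-determined fu≡fv gu≡gv))
    ... | yes _     | no _      | no _    = s≤s z≤n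
    ... | no _      | _         | no _    = s≤s z≤n

    length-runHeadsAfter-map : ∀ u L →
      length (runHeadsAfter _≟ᶻ_ (h u) (map h L)) ≤
      length (runHeadsAfter _≟ˣ_ (f u) (map f L)) + length (runHeadsAfter _≟ʸ_ (g u) (map g L))
    length-runHeadsAfter-map u []      = z≤n
    length-runHeadsAfter-map u (v ∷ L) = begin
      length (runHeadsAfter _≟ᶻ_ (h u) (map h (v ∷ L)))
        ≡⟨ length-runHeadsAfter-∷ _≟ᶻ_ (h u) (h v) (map h L) ⟩
      δᶻ + Rᶻ
        ≤⟨ +-mono-≤ (differ-determined u v) (length-runHeadsAfter-map v L) ⟩
      (δˣ + δʸ) + (Rˣ + Rʸ)
        ≡⟨ +-interchange δˣ δʸ Rˣ Rʸ ⟩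
      (δˣ + Rˣ) + (δʸ + Rʸ)
        ≡⟨ cong₂ _+_ (length-runHeadsAfter-∷ _≟ˣ_ (f u) (f v) (map f L))
                     (length-runHeadsAfter-∷ _≟ʸ_ (g u) (g v) (map g L)) ⟨
      length (runHeadsAfter _≟ˣ_ (f u) (map f (v ∷ L))) + length (runHeadsAfter _≟ʸ_ (g u) (map g (v ∷ L))) ∎
      where
      open ≤-Reasoning
      δˣ = differ _≟ˣ_ (f u) (f v)
      δʸ = differ _≟ʸ_ (g u) (g v)
      δᶻ = differ _≟ᶻ_ (h u) (h v)
      Rˣ = length (runHeadsAfter _≟ˣ_ (f v) (map f L))
      Rʸ = length (runHeadsAfter _≟ʸ_ (g v) (map g L))
      Rᶻ = length (runHeadsAfter _≟ᶻ_ (h v) (map h L))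

  length-runHeads-map : ∀ u L →
    suc (length (runHeads _≟ᶻ_ (map h (u ∷ L)))) ≤
    length (runHeads _≟ˣ_ (map f (u ∷ L))) + length (runHeads _≟ʸ_ (map g (u ∷ L)))
  length-runHeads-map u L =
    s≤s (≤-trans (s≤s (length-runHeadsAfter-map u L)) (≤-reflexive (sym (+-suc _ _))))

-- Suffixient sets of periodic words

atLeast : ℕ → (n : ℕ) → Subset n
atLeast zero    n       = ⊤
atLeast (suc m) zero    = []
atLeast (suc m) (suc n) = outside ∷ atLeast m n

∣atLeast∣ : ∀ m n → ∣ atLeast m n ∣ ≡ n ∸ m
∣atLeast∣ zero    n       = ∣⊤∣≡n n
∣atLeast∣ (suc m) zero    = refl
∣atLeast∣ (suc m) (suc n) = ∣atLeast∣ m n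

∈-atLeast : ∀ m {n} (j : Fin n) → m ≤ toℕ j → j ∈ₛ atLeast m n
∈-atLeast zero    j        _         = ∈⊤
∈-atLeast (suc m) (fsuc j) (s≤s m≤j) = there (∈-atLeast m j m≤j)

IsSuffixOf-trans : ∀ {A : Set} {x y z : List A} → x IsSuffixOf y → y IsSuffixOf z → x IsSuffixOf z
IsSuffixOf-trans {x = x} (u , refl) (v , refl) = v ++ u , sym (++-assoc v u x)

occurrence-end : ∀ {A : Set} {w u v : List A} x c → w ≡ u ++ ((x ∷ʳ c) ++ v) →
  ∃[ q ] q < length w × (x ∷ʳ c) IsSuffixOf take (suc q) w
occurrence-end {w = w} {u} {v} x c w≡ = length (u ++ x) , q<∣w∣ , u , prefix
  where
  w≡′ : w ≡ (u ++ x) ++ c ∷ v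
  w≡′ = trans w≡ (trans (cong (u ++_) (++-assoc x (c ∷ []) v)) (sym (++-assoc u x (c ∷ v))))
  q<∣w∣ : length (u ++ x) < length w
  q<∣w∣ = subst (length (u ++ x) <_) (cong length (sym w≡′))
    (subst (length (u ++ x) <_) (sym (length-++-sucʳ (u ++ x) c v)) (s≤s (length-++-≤ˡ (u ++ x))))
  prefix : take (suc (length (u ++ x))) w ≡ u ++ (x ∷ʳ c)
  prefix = trans (cong (take _) w≡′) (trans (take-suc-length (u ++ x) c v) (++-assoc u x (c ∷ [])))

module _ {A : Set} (w : List A) (m : ℕ) where

  private
    suffixOfPrefixIn-atLeast : ∀ {y q} (q<∣w∣ : q < length w) → m ≤ q → y IsSuffixOf take (suc q) w →
      Σ (Fin (length w)) λ j → (j ∈ₛ atLeast m (length w)) × (y IsSuffixOf take (suc (toℕ j)) w)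
    suffixOfPrefixIn-atLeast {y} q<∣w∣ m≤q y⊒ =
        fromℕ< q<∣w∣
      , ∈-atLeast m _ (subst (m ≤_) (sym (FinP.toℕ-fromℕ< q<∣w∣)) m≤q)
      , subst (λ i → y IsSuffixOf take (suc i) w) (sym (FinP.toℕ-fromℕ< q<∣w∣)) y⊒

  periodic⇒atLeast-suffixient : ∀ p → m ≤ p → p + m ≤ length w →
    (∀ n → n ≤ m → take n w IsSuffixOf take (p + n) w) → Suffixient w (atLeast m (length w))
  periodic⇒atLeast-suffixient p m≤p p+m≤∣w∣ shift y (x , c , refl , _ , u , v , w≡)
    with occurrence-end {u = u} {v} x c w≡
  ... | q , q<∣w∣ , y⊒ with m ≤? q
  ...   | yes m≤q = suffixOfPrefixIn-atLeast q<∣w∣ m≤q y⊒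
  ...   | no  m≰q = suffixOfPrefixIn-atLeast p+q<∣w∣ (≤-trans m≤p (m≤m+n p q))
                      (subst (λ i → y IsSuffixOf take i w) (+-suc p q) (IsSuffixOf-trans y⊒ (shift (suc q) q<m)))
    where
    q<m : q < m
    q<m = ≰⇒> m≰q
    p+q<∣w∣ : p + q < length w
    p+q<∣w∣ = <-≤-trans (+-monoʳ-< p q<m) p+m≤∣w∣

linearised-prefix-recurs : ∀ {A : Set} (u e : List A) m n → n ≤ m → m ≤ length u →
  take n (u ++ take m u ++ e) IsSuffixOf take (length u + n) (u ++ take m u ++ e)
linearised-prefix-recurs u e m n n≤m m≤∣u∣ = u , (begin
  take (length u + n) (u ++ take m u ++ e) ≡⟨ take-++ʳ n u (take m u ++ e) ⟩
  u ++ take n (take m u ++ e)              ≡⟨ cong (u ++_) (take-++ˡ n (take m u) e n≤∣take-m-u∣) ⟩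
  u ++ take n (take m u)                   ≡⟨ cong (u ++_) (take-take-≤ u n≤m) ⟩
  u ++ take n u                            ≡⟨ cong (u ++_) (take-++ˡ n u (take m u ++ e) (≤-trans n≤m m≤∣u∣)) ⟨
  u ++ take n (u ++ take m u ++ e)         ∎)
  where
  open ≡-Reasoning
  n≤∣take-m-u∣ : n ≤ length (take m u)
  n≤∣take-m-u∣ = subst (n ≤_) (sym (length-take-≤ u m≤∣u∣)) n≤m

linearised-suffixient : ∀ {A : Set} (u e : List A) m → m ≤ length u →
  Suffixient (u ++ take m u ++ e) (atLeast m (length (u ++ take m u ++ e)))
linearised-suffixient u e m m≤∣u∣ = periodic⇒atLeast-suffixient (u ++ take m u ++ e) m (length u) m≤∣u∣
  (subst (length u + m ≤_) (sym (length-linearised u e m m≤∣u∣)) (+-monoʳ-≤ (length u) (m≤m+n m (length e))))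
  (λ n n≤m → linearised-prefix-recurs u e m n n≤m m≤∣u∣)

withEnd-linearised : ∀ {σ} (u : List (Fin σ)) m →
  withEnd (u ++ take m u) ≡ map fsuc u ++ take m (map fsuc u) ++ fzero ∷ []
withEnd-linearised u m = begin
  map fsuc (u ++ take m u) ++ fzero ∷ []              ≡⟨ cong (_∷ʳ fzero) (map-++ fsuc u (take m u)) ⟩
  (map fsuc u ++ map fsuc (take m u)) ++ fzero ∷ []   ≡⟨ ++-assoc (map fsuc u) (map fsuc (take m u)) (fzero ∷ []) ⟩
  map fsuc u ++ map fsuc (take m u) ++ fzero ∷ []     ≡⟨ cong (λ xs → map fsuc u ++ xs ∷ʳ fzero) (take-map m u) ⟨
  map fsuc u ++ take m (map fsuc u) ++ fzero ∷ []     ∎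
  where open ≡-Reasoning

minSuffixientSize-linearised≤ : ∀ {σ} (u : List (Fin σ)) m → m ≤ length u →
  ∀ {χ} → IsMinSuffixientSize (withEnd (u ++ take m u)) χ → χ ≤ suc (length u)
minSuffixientSize-linearised≤ u m m≤∣u∣ {χ} χ-min
  with (_ , minimal) ← subst (λ w → IsMinSuffixientSize w χ) (withEnd-linearised u m) χ-min = begin
  χ                                    ≤⟨ minimal _ (linearised-suffixient u′ (fzero ∷ []) m m≤∣u′∣) ⟩
  ∣ atLeast m (length W′) ∣            ≡⟨ ∣atLeast∣ m (length W′) ⟩
  length W′ ∸ m                        ≡⟨ cong (_∸ m) (length-linearised u′ (fzero ∷ []) m m≤∣u′∣) ⟩
  length u′ + (m + 1) ∸ m               ≡⟨ cong (_∸ m) (+-comm (length u′) (m + 1)) ⟩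
  m + 1 + length u′ ∸ m                 ≡⟨ cong (_∸ m) (+-assoc m 1 (length u′)) ⟩
  m + suc (length u′) ∸ m               ≡⟨ m+n∸m≡n m (suc (length u′)) ⟩
  suc (length u′)                       ≡⟨ cong suc (length-map fsuc u) ⟩
  suc (length u)                       ∎
  where
  open ≤-Reasoning
  u′ = map fsuc u
  W′ = u′ ++ take m u′ ++ fzero ∷ []
  m≤∣u′∣ : m ≤ length u′
  m≤∣u′∣ = subst (m ≤_) (sym (length-map fsuc u)) m≤∣u∣

-- The BWT of a linearised de Bruijn sequence

length-withEnd : ∀ {σ} (w : List (Fin σ)) → length (withEnd w) ≡ suc (length w)
length-withEnd w = trans (length-++ (map fsuc w)) (trans (+-comm _ 1) (cong suc (length-map fsuc w)))

dollarFree⇒letters : ∀ {σ} {zs : List (Fin (suc σ))} → All (_≢ fzero) zs → ∃[ x ] zs ≡ map fsuc x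
dollarFree⇒letters {zs = []}         []            = [] , refl
dollarFree⇒letters {zs = fzero ∷ _}  (≢$ ∷ _)      = ⊥-elim (≢$ refl)
dollarFree⇒letters {zs = fsuc c ∷ _} (_ ∷ free)    with dollarFree⇒letters free
... | x , refl = c ∷ x , refl

deBruijn-windows : ∀ {σ k′} (D : List (Fin σ)) → IsDeBruijn σ (suc k′) D →
  ∀ {i} → i < length D → suc k′ ≤ length D →
  let U = rotate i D in
  ∀ z → length z ≡ suc k′ → ∃[ t ] t < length (U ++ take k′ U) × take (suc k′) (drop t (U ++ take k′ U)) ≡ z
deBruijn-windows {k′ = k′} D (_ , windows-onto , _) {i} i<∣D∣ k≤∣D∣ z ∣z∣≡k
  with t₀ , t₀<∣D∣ , window≡z ← windows-onto z ∣z∣≡k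
  with t , t<∣D∣ , rotate-t≡ ← rotate-rotate D (<⇒≤ i<∣D∣) t₀<∣D∣ =
  t , <-≤-trans t<∣U∣ (length-++-≤ˡ U) , (begin
    take (suc k′) (drop t (U ++ take k′ U)) ≡⟨ linearised-window≡cycWindow k′ t U t<∣U∣ k≤∣U∣ ⟩
    take (suc k′) (rotate t U)               ≡⟨ cong (take (suc k′)) rotate-t≡ ⟩
    cycWindow (suc k′) D t₀                  ≡⟨ window≡z ⟩
    z                                        ∎)
  where
  open ≡-Reasoning
  U = rotate i D
  ∣U∣≡∣D∣ : length U ≡ length D
  ∣U∣≡∣D∣ = length-rotate i D
  t<∣U∣ : t < length U
  t<∣U∣ = subst (t <_) (sym ∣U∣≡∣D∣) t<∣D∣
  k≤∣U∣ : suc k′ ≤ length U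
  k≤∣U∣ = subst (suc k′ ≤_) (sym ∣U∣≡∣D∣) k≤∣D∣

module BWTRuns {σ : ℕ} .{{_ : NonZero σ}} (k′ : ℕ) (v : List (Fin σ)) (k′≤∣v∣ : k′ ≤ length v)
  (windows : ∀ z → length z ≡ suc k′ → ∃[ t ] t < length v × take (suc k′) (drop t v) ≡ z)
  where

  Row : Set
  Row = List (Fin (suc σ))

  W : Row
  W = withEnd v

  open DecTotalOrder (lexOrder σ) using () renaming (_≤_ to _≼_; trans to ≼-trans; antisym to ≼-antisym)
  open Data.List.Sort (lexOrder σ) using (sort; sort-↭; sort-↗)

  rows : List Row
  rows = sort (rotations W)

  -- The default fzero is never used: rows have length |W| > 0.
  bwtChar : Row → Fin (suc σ)
  bwtChar ρ = fromMaybe fzero (last ρ)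

  context : Row → Row
  context = take k′

  kmer : Row → Row
  kmer ρ = bwtChar ρ ∷ context ρ

  goodRows : List Row
  goodRows = filter (λ ρ → all? (λ c → ¬? (c FinP.≟ fzero)) (context ρ)) rows

  ∈-rows⇒length : ∀ {ρ} → ρ ∈ rows → length ρ ≡ length W
  ∈-rows⇒length ρ∈ with ∈-map⁻ (λ j → rotate j W) (∈-resp-↭ (sort-↭ (rotations W)) ρ∈)
  ... | j , _ , refl = length-rotate j W

  ∈-rows⁺ : ∀ {j} → j < length W → rotate j W ∈ rows
  ∈-rows⁺ j<∣W∣ = ∈-resp-↭ (↭-sym (sort-↭ (rotations W))) (∈-map⁺ (λ j → rotate j W) (∈-upTo⁺ j<∣W∣))

  BWT≡map-bwtChar : BWT σ W ≡ map bwtChar rows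
  BWT≡map-bwtChar = mapMaybe≡map (All.tabulate last≡just)
    where
    last≡just : ∀ {ρ} → ρ ∈ rows → last ρ ≡ just (bwtChar ρ)
    last≡just {[]}    ρ∈ with () ← trans (∈-rows⇒length ρ∈) (length-withEnd v)
    last≡just {c ∷ ρ} _  = last≡just-fromMaybe fzero c ρ

  length-runHeads-bwtChar≤runs : length (runHeads FinP._≟_ (map bwtChar goodRows)) ≤ runs (BWT σ W)
  length-runHeads-bwtChar≤runs = begin
    length (runHeads FinP._≟_ (map bwtChar goodRows)) ≤⟨ length-runHeads-mono-⊑ FinP._≟_ (map⁺ bwtChar (filter-⊆ _ rows)) ⟩
    length (runHeads FinP._≟_ (map bwtChar rows))     ≡⟨ cong (length ∘′ runHeads FinP._≟_) BWT≡map-bwtChar ⟨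
    length (runHeads FinP._≟_ (BWT σ W))              ≡⟨ runs≡length-runHeads (BWT σ W) ⟨
    runs (BWT σ W)                                    ∎
    where open ≤-Reasoning

  _≟ᵣ_ : DecidableEquality Row
  _≟ᵣ_ = ≡-dec FinP._≟_

  contexts-sorted : Linked _≼_ (map context goodRows)
  contexts-sorted = Linked.map⁺ (Linked.map (take-mono-Lex-≤ k′) (Linked.filter⁺ _ ≼-trans (sort-↗ (rotations W))))

  context∈words : ∀ {ρ} → ρ ∈ goodRows → context ρ ∈ map (map fsuc) (words (allFin σ) k′)
  context∈words {ρ} ρ∈ with ∈-filter⁻ _ ρ∈
  ... | ρ∈rows , free with dollarFree⇒letters free
  ...   | x , ctx≡ = subst (_∈ _) (sym ctx≡) (∈-map⁺ (map fsuc) x∈words)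
    where
    k′≤∣ρ∣ : k′ ≤ length ρ
    k′≤∣ρ∣ = subst (k′ ≤_) (sym (trans (∈-rows⇒length ρ∈rows) (length-withEnd v))) (m≤n⇒m≤1+n k′≤∣v∣)
    ∣x∣≡k′ : length x ≡ k′
    ∣x∣≡k′ = trans (sym (length-map fsuc x)) (trans (cong length (sym ctx≡)) (length-take-≤ ρ k′≤∣ρ∣))
    x∈words : x ∈ words (allFin σ) k′
    x∈words = subst (λ n → x ∈ words (allFin σ) n) ∣x∣≡k′ (∈-words (All.universal ∈-allFin x))

  length-runHeads-context≤ : length (runHeads _≟ᵣ_ (map context goodRows)) ≤ σ ^ k′
  length-runHeads-context≤ = begin
    length (runHeads _≟ᵣ_ (map context goodRows))      ≤⟨ Unique⇒length≤ unique ⊆contexts ⟩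
    length (map (map fsuc) (words (allFin σ) k′))       ≡⟨ length-map (map fsuc) (words (allFin σ) k′) ⟩
    length (words (allFin σ) k′)                        ≡⟨ length-words (allFin σ) k′ ⟩
    length (allFin σ) ^ k′                              ≡⟨ cong (_^ k′) (length-allFin σ) ⟩
    σ ^ k′                                              ∎
    where
    open ≤-Reasoning
    unique = runHeads-unique _≟ᵣ_ ≼-trans (λ x≼y y≼x → Pointwise-≡⇒≡ (≼-antisym x≼y y≼x)) contexts-sorted
    ⊆contexts : ∀ {z} → z ∈ runHeads _≟ᵣ_ (map context goodRows) → z ∈ map (map fsuc) (words (allFin σ) k′)
    ⊆contexts z∈ with ∈-map⁻ context (lookup (runHeads-⊑ _≟ᵣ_ _) z∈)
    ... | ρ , ρ∈ , refl = context∈words ρ∈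

  kmer-realised : ∀ t → t < length v → length (take (suc k′) (drop t v)) ≡ suc k′ →
    ∃[ ρ ] ρ ∈ goodRows × kmer ρ ≡ map fsuc (take (suc k′) (drop t v))
  kmer-realised t t<∣v∣ ∣window∣ with drop t v in drop≡
  ... | c ∷ rest = ρ , ∈-filter⁺ _ (∈-rows⁺ suc-t<∣W∣) free , cong₂ _∷_ bwtChar≡ context≡
    where
    drop-W : drop t W ≡ fsuc c ∷ (map fsuc rest ∷ʳ fzero)
    drop-W = trans (drop-++ˡ t (map fsuc v) (fzero ∷ []) (subst (t ≤_) (sym (length-map fsuc v)) (<⇒≤ t<∣v∣)))
                   (cong (_∷ʳ fzero) (trans (drop-map t v) (cong (map fsuc) drop≡)))
    ρ = rotate (suc t) W
    ρ≡ : ρ ≡ (map fsuc rest ∷ʳ fzero) ++ (take t W ∷ʳ fsuc c)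
    ρ≡ = drop≡∷⇒rotate-suc t W drop-W
    bwtChar≡ : bwtChar ρ ≡ fsuc c
    bwtChar≡ = cong (fromMaybe fzero) (trans
      (cong last (trans ρ≡ (sym (++-assoc (map fsuc rest ∷ʳ fzero) (take t W) (fsuc c ∷ [])))))
      (last-∷ʳ (map fsuc rest ∷ʳ fzero ++ take t W) (fsuc c)))
    k′≤∣rest∣ : k′ ≤ length rest
    k′≤∣rest∣ = m⊓n≡m⇒m≤n (trans (sym (length-take k′ rest)) (suc-injective ∣window∣))
    context≡ : context ρ ≡ map fsuc (take k′ rest)
    context≡ = begin
      take k′ ρ                                             ≡⟨ cong (take k′) ρ≡ ⟩
      take k′ ((map fsuc rest ∷ʳ fzero) ++ (take t W ∷ʳ fsuc c)) ≡⟨ cong (take k′) (++-assoc (map fsuc rest) (fzero ∷ []) _) ⟩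
      take k′ (map fsuc rest ++ fzero ∷ (take t W ∷ʳ fsuc c)) ≡⟨ take-++ˡ k′ (map fsuc rest) _ k′≤∣rest∣′ ⟩
      take k′ (map fsuc rest)                               ≡⟨ take-map k′ rest ⟩
      map fsuc (take k′ rest)                               ∎
      where
      open ≡-Reasoning
      k′≤∣rest∣′ : k′ ≤ length (map fsuc rest)
      k′≤∣rest∣′ = subst (k′ ≤_) (sym (length-map fsuc rest)) k′≤∣rest∣
    free : All (_≢ fzero) (context ρ)
    free = subst (All (_≢ fzero)) (sym context≡) (All.map⁺ (All.universal (λ _ ()) (take k′ rest)))
    suc-t<∣W∣ : suc t < length W
    suc-t<∣W∣ = subst (suc t <_) (sym (length-withEnd v)) (s≤s t<∣v∣)

  σ^k≤length-runHeads-kmer : σ ^ suc k′ ≤ length (runHeads _≟ᵣ_ (map kmer goodRows))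
  σ^k≤length-runHeads-kmer = begin
    σ ^ suc k′                                           ≡⟨ cong (_^ suc k′) (length-allFin σ) ⟨
    length (allFin σ) ^ suc k′                           ≡⟨ length-words (allFin σ) (suc k′) ⟨
    length (words (allFin σ) (suc k′))                   ≡⟨ length-map (map fsuc) (words (allFin σ) (suc k′)) ⟨
    length (map (map fsuc) (words (allFin σ) (suc k′)))  ≤⟨ Unique⇒length≤ unique ⊆kmers ⟩
    length (runHeads _≟ᵣ_ (map kmer goodRows))           ∎
    where
    open ≤-Reasoning
    unique = Unique.map⁺ (map-injective FinP.suc-injective) (words-unique (suc k′) (Unique.allFin⁺ σ))
    ⊆kmers : ∀ {p} → p ∈ map (map fsuc) (words (allFin σ) (suc k′)) → p ∈ runHeads _≟ᵣ_ (map kmer goodRows)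
    ⊆kmers p∈ with ∈-map⁻ (map fsuc) p∈
    ... | z , z∈ , refl with windows z (∈-words⇒length (allFin σ) (suc k′) z∈)
    ...   | t , t<∣v∣ , refl with kmer-realised t t<∣v∣ (∈-words⇒length (allFin σ) (suc k′) z∈)
    ...     | ρ , ρ∈ , kmer≡ = ∈-runHeads⁺ _≟ᵣ_ _ (subst (_∈ _) kmer≡ (∈-map⁺ kmer ρ∈))

  bwt-runs-bound : suc (σ ^ suc k′) ≤ runs (BWT σ W) + σ ^ k′
  bwt-runs-bound = begin
    suc (σ ^ suc k′)                                   ≤⟨ s≤s σ^k≤length-runHeads-kmer ⟩
    suc (length (runHeads _≟ᵣ_ (map kmer goodRows)))   ≤⟨ pairing goodRows kmers-nonempty ⟩
    length (runHeads FinP._≟_ (map bwtChar goodRows)) + length (runHeads _≟ᵣ_ (map context goodRows))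
      ≤⟨ +-mono-≤ length-runHeads-bwtChar≤runs length-runHeads-context≤ ⟩
    runs (BWT σ W) + σ ^ k′                            ∎
    where
    open ≤-Reasoning
    kmers-nonempty : 0 < length (runHeads _≟ᵣ_ (map kmer goodRows))
    kmers-nonempty = <-≤-trans (m^n>0 σ (suc k′)) σ^k≤length-runHeads-kmer
    pairing : ∀ L → 0 < length (runHeads _≟ᵣ_ (map kmer L)) →
      suc (length (runHeads _≟ᵣ_ (map kmer L))) ≤
      length (runHeads FinP._≟_ (map bwtChar L)) + length (runHeads _≟ᵣ_ (map context L))
    pairing (ρ ∷ L) _ = length-runHeads-map FinP._≟_ _≟ᵣ_ _≟ᵣ_ bwtChar context kmer (cong₂ _∷_) ρ L

n<m^n : ∀ {m} → 2 ≤ m → ∀ n → n < m ^ n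
n<m^n 2≤m zero = s≤s z≤n
n<m^n {m} 2≤m@(s≤s (s≤s _)) (suc n) = begin
  suc (suc n)          ≤⟨ s≤s (n<m^n 2≤m n) ⟩
  1 + m ^ n            ≤⟨ +-monoˡ-≤ (m ^ n) (m^n>0 m n) ⟩
  m ^ n + m ^ n        ≡⟨ cong (m ^ n +_) (+-identityʳ (m ^ n)) ⟨
  2 * m ^ n            ≤⟨ *-monoˡ-≤ (m ^ n) 2≤m ⟩
  m ^ suc n            ∎
  where open ≤-Reasoning

ratio-bound : ∀ s M χ r → χ ≤ suc (suc s * M) → suc (suc s * M) ≤ r + M → χ * s < suc s * r
ratio-bound s M χ r χ≤1+N 1+N≤r+M = begin-strict
  χ * s                ≤⟨ *-monoˡ-≤ s χ≤1+N ⟩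
  s + N * s            <⟨ n<1+n (s + N * s) ⟩
  suc s + N * s        ≤⟨ +-cancelʳ-≤ N (suc s + N * s) (suc s * r) σ+Ns+N≤σr+N ⟩
  suc s * r            ∎
  where
  open ≤-Reasoning
  N = suc s * M
  expand : ∀ a n → suc a + n * a + n ≡ suc a * suc n
  expand = solve-∀
  σ+Ns+N≤σr+N : suc s + N * s + N ≤ suc s * r + N
  σ+Ns+N≤σr+N = begin
    suc s + N * s + N  ≡⟨ expand s N ⟩
    suc s * suc N      ≤⟨ *-monoʳ-≤ (suc s) 1+N≤r+M ⟩
    suc s * (r + M)    ≡⟨ *-distribˡ-+ (suc s) r M ⟩
    suc s * r + N      ∎

theorem4 : (σ k : ℕ) → 2 ≤ σ → 2 ≤ k →
    (D : List (Fin σ)) → IsDeBruijn σ k D →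
    (i : ℕ) → i < length D →
    (U : List (Fin σ)) → U ≡ rotate i D →
    (wlin : List (Fin σ)) → wlin ≡ U ++ take (k ∸ 1) U →
    (χ : ℕ) → IsMinSuffixientSize (withEnd wlin) χ →
    (r : ℕ) → r ≡ runs (BWT σ (withEnd wlin)) →
    χ * (σ ∸ 1) < σ * r
theorem4 σ@(suc s) (suc k′) 2≤σ _ D deBruijn@(∣D∣≡σ^k , _) i i<∣D∣ _ refl _ refl χ χ-min _ refl =
  ratio-bound s (σ ^ k′) χ _ χ≤1+σ^k r-bound
  where
  U = rotate i D
  k≤∣D∣ : suc k′ ≤ length D
  k≤∣D∣ = subst (suc k′ ≤_) (sym ∣D∣≡σ^k) (<⇒≤ (n<m^n 2≤σ (suc k′)))
  k′≤∣U∣ : k′ ≤ length U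
  k′≤∣U∣ = subst (k′ ≤_) (sym (length-rotate i D)) (≤-trans (n≤1+n k′) k≤∣D∣)
  χ≤1+σ^k : χ ≤ suc (σ ^ suc k′)
  χ≤1+σ^k = subst (λ n → χ ≤ suc n) (trans (length-rotate i D) ∣D∣≡σ^k)
    (minSuffixientSize-linearised≤ U k′ k′≤∣U∣ χ-min)
  r-bound : suc (σ ^ suc k′) ≤ runs (BWT σ (withEnd (U ++ take k′ U))) + σ ^ k′
  r-bound = BWTRuns.bwt-runs-bound k′ (U ++ take k′ U) (≤-trans k′≤∣U∣ (length-++-≤ˡ U))
    (deBruijn-windows D deBruijn i<∣D∣ k≤∣D∣)
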